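{- Let \(G\) be a minimal counterexample to the Erd\H{o}s--Gy\'arf\'as conjecture (as defined in the context), and let \(V_3=\{v\in V(G): d(v)=3\}\). Then \(|V_3|\geq \frac{4}{7}|V(G)|\).
   Context: All graphs are finite, simple and undirected; \(d(v)\) denotes the degree of a vertex \(v\) and \(\delta(G)\) the minimum degree of \(G\). A minimal counterexample to the Erd\H{o}s--Gy\'arf\'as conjecture is a graph \(G\) with \(\delta(G)\geq 3\) that contains no cycle whose length is a power of \(2\), chosen so that its number of vertices is minimum among all such graphs and, subject to that, its number of edges is minimum. -}

module Defs where

open import Data.Nat using (ℕ; zero; suc; _+_; _*_; _^_; _≤_; _<_; _≥_)
open import Data.Nat.Properties using (_<?_)
open import Data.Bool using (Bool; true; false; if_then_else_; _∧_)
open import Data.Fin using (Fin; zero; suc; toℕ; inject₁; fromℕ)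
open import Data.List using (List; map; allFin)
open import Data.Nat.ListAction using (sum)
open import Data.Product using (Σ; ∃; _×_; _,_)
open import Relation.Nullary using (¬_)
open import Relation.Nullary.Decidable using (⌊_⌋)
open import Relation.Binary.PropositionalEquality using (_≡_)
open import Function.Definitions using (Injective)

record Graph : Set where
  field
    n      : ℕ
    adj    : Fin n → Fin n → Bool
    adj-sym    : ∀ u v → adj u v ≡ adj v u
    adj-irrefl : ∀ v → adj v v ≡ false

open Graph public

∣V∣ : Graph → ℕ
∣V∣ G = n G

𝟙 : Bool → ℕ
𝟙 true  = 1
𝟙 false = 0

degree : (G : Graph) → Fin (n G) → ℕ
degree G v = sum (map (λ u → 𝟙 (adj G v u)) (allFin (n G)))

∣E∣ : Graph → ℕ
∣E∣ G = sum (map (λ u → sum (map (λ v → 𝟙 (⌊ toℕ u <? toℕ v ⌋ ∧ adj G u v)) (allFin (n G))))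
                 (allFin (n G)))

MinDegreeAtLeast : Graph → ℕ → Set
MinDegreeAtLeast G k = ∀ v → k ≤ degree G v

record Cycle (G : Graph) (m : ℕ) : Set where
  field
    f     : Fin (suc (suc (suc m))) → Fin (n G)
    f-inj : Injective _≡_ _≡_ f
    steps : ∀ (i : Fin (suc (suc m))) → adj G (f (inject₁ i)) (f (suc i)) ≡ true
    close : adj G (f (fromℕ (suc (suc m)))) (f zero) ≡ true

HasCycleOfLength : Graph → ℕ → Set
HasCycleOfLength G k = Σ ℕ λ m → (k ≡ m + 3) × Cycle G m

IsPowerOf2 : ℕ → Set
IsPowerOf2 k = ∃ λ j → k ≡ 2 ^ j

Counterexample : Graph → Set
Counterexample G =
  1 ≤ n G × MinDegreeAtLeast G 3 × (∀ k → IsPowerOf2 k → ¬ HasCycleOfLength G k)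

MinimalCounterexample : Graph → Set
MinimalCounterexample G =
  Counterexample G ×
  (∀ H → Counterexample H → (∣V∣ G ≤ ∣V∣ H) × (∣V∣ H ≡ ∣V∣ G → ∣E∣ G ≤ ∣E∣ H))

∣V₃∣ : Graph → ℕ
∣V₃∣ G = sum (map (λ v → 𝟙 ⌊ degree G v Data.Nat.≟ 3 ⌋) (allFin (n G)))

-- Deleting an edge whose ends both have degree at least 4 keeps the minimum degree at least 3
-- and creates no cycle, so by edge-minimality every edge of G meets V₃: the vertices of degree
-- at least 4 form an independent set. Counting the edges between them and V₃ gives
-- 4 |V ∖ V₃| ≤ 3 |V₃|, that is 4 |V| ≤ 7 |V₃|.

module Submission where

open import Defs
open import Data.Nat using (ℕ; zero; suc; _+_; _*_; _≤_; _<_; z≤n; s≤s; s≤s⁻¹)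
open import Data.Nat.Properties
open import Data.Nat.ListAction as List using ()
open import Data.Bool using (Bool; true; false; _∧_; not)
open import Data.Bool.Properties using (∧-identityʳ; ∧-zeroʳ)
open import Data.Fin using (Fin; zero; suc; toℕ)
import Data.Fin.Properties as Fin
open import Data.List using (map; allFin; tabulate)
open import Data.List.Properties using (map-tabulate; map-cong)
open import Data.Product using (_×_; _,_; proj₂)
open import Data.Sum using (_⊎_; inj₁; inj₂)
open import Function using (_∘_; id; mk⇔)
open import Relation.Nullary using (¬_; Dec; does; yes; no; contradiction)
open import Relation.Nullary.Decidable using (⌊_⌋; _×-dec_; _⊎-dec_; dec-true; dec-false; does-⇔; isYes≗does)
open import Relation.Binary.PropositionalEquality
open import Relation.Binary.Definitions using (tri<; tri≈; tri>)
open import Algebra.Properties.Semiring.Sum +-*-semiring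
  using (sum-syntax; ∑-distrib-+; ∑-comm; sum-cong-≗; *-distribˡ-sum)

sum-map-allFin : ∀ n (f : Fin n → ℕ) → List.sum (map f (allFin n)) ≡ ∑[ i < n ] f i
sum-map-allFin n f = trans (cong List.sum (map-tabulate id f)) (sum-tabulate n f)
  where
  sum-tabulate : ∀ n (f : Fin n → ℕ) → List.sum (tabulate f) ≡ ∑[ i < n ] f i
  sum-tabulate zero    f = refl
  sum-tabulate (suc n) f = cong (f zero +_) (sum-tabulate n (f ∘ suc))

∑-mono-≤ : ∀ {n} {f g : Fin n → ℕ} → (∀ i → f i ≤ g i) → ∑[ i < n ] f i ≤ ∑[ i < n ] g i
∑-mono-≤ {zero}  f≤g = z≤n
∑-mono-≤ {suc n} f≤g = +-mono-≤ (f≤g zero) (∑-mono-≤ (f≤g ∘ suc))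

∑-mono-< : ∀ {n} {f g : Fin n → ℕ} → (∀ i → f i ≤ g i) → ∀ j → f j < g j →
           ∑[ i < n ] f i < ∑[ i < n ] g i
∑-mono-< f≤g zero    fj<gj = +-mono-<-≤ fj<gj (∑-mono-≤ (f≤g ∘ suc))
∑-mono-< f≤g (suc j) fj<gj = +-mono-≤-< (f≤g zero) (∑-mono-< (f≤g ∘ suc) j fj<gj)

∑-1 : ∀ n → ∑[ i < n ] 1 ≡ n
∑-1 zero    = refl
∑-1 (suc n) = cong suc (∑-1 n)

∑-≤-suc : ∀ {n} {f g : Fin n → ℕ} → (∀ i → f i ≤ suc (g i)) →
          (∀ i j → g i < f i → g j < f j → i ≡ j) →
          ∑[ i < n ] f i ≤ suc (∑[ i < n ] g i)
∑-≤-suc {zero}          f≤1+g unique = z≤n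
∑-≤-suc {suc n} {f} {g} f≤1+g unique with f zero ≤? g zero
... | yes f₀≤g₀ = ≤-trans (+-mono-≤ f₀≤g₀ (∑-≤-suc (f≤1+g ∘ suc) unique-tail))
                          (≤-reflexive (+-suc (g zero) _))
  where
  unique-tail : ∀ i j → g (suc i) < f (suc i) → g (suc j) < f (suc j) → i ≡ j
  unique-tail i j gi<fi gj<fj = Fin.suc-injective (unique _ _ gi<fi gj<fj)
... | no f₀≰g₀ = +-mono-≤ (f≤1+g zero) (∑-mono-≤ tail-≤)
  where
  tail-≤ : ∀ i → f (suc i) ≤ g (suc i)
  tail-≤ i with f (suc i) ≤? g (suc i)
  ... | yes fi≤gi = fi≤gi
  ... | no fi≰gi = contradiction (unique _ _ (≰⇒> f₀≰g₀) (≰⇒> fi≰gi)) λ ()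

𝟙≤1 : ∀ b → 𝟙 b ≤ 1
𝟙≤1 true  = ≤-refl
𝟙≤1 false = z≤n

𝟙-not+𝟙 : ∀ b → 𝟙 (not b) + 𝟙 b ≡ 1
𝟙-not+𝟙 true  = refl
𝟙-not+𝟙 false = refl

𝟙-∧-mono : ∀ c {a b} → (a ≡ true → b ≡ true) → 𝟙 (c ∧ a) ≤ 𝟙 (c ∧ b)
𝟙-∧-mono false     a⇒b = z≤n
𝟙-∧-mono true {false} a⇒b = z≤n
𝟙-∧-mono true {true}  a⇒b rewrite a⇒b refl = ≤-refl

∣E∣-∑ : ∀ G → ∣E∣ G ≡ ∑[ x < n G ] ∑[ y < n G ] 𝟙 (⌊ toℕ x <? toℕ y ⌋ ∧ adj G x y)
∣E∣-∑ G = trans (sum-map-allFin (n G) _) (sum-cong-≗ {n G} λ x → sum-map-allFin (n G) _)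

degree-∑ : ∀ G x → degree G x ≡ ∑[ y < n G ] 𝟙 (adj G x y)
degree-∑ G x = sum-map-allFin (n G) (𝟙 ∘ adj G x)

module _ {m : ℕ} (u v : Fin m) where

  Joins : Fin m → Fin m → Set
  Joins x y = (x ≡ u × y ≡ v) ⊎ (x ≡ v × y ≡ u)

  joins? : ∀ x y → Dec (Joins x y)
  joins? x y = ((x Fin.≟ u) ×-dec (y Fin.≟ v)) ⊎-dec ((x Fin.≟ v) ×-dec (y Fin.≟ u))

  Joins-sym : ∀ {x y} → Joins x y → Joins y x
  Joins-sym (inj₁ (x≡u , y≡v)) = inj₂ (y≡v , x≡u)
  Joins-sym (inj₂ (x≡v , y≡u)) = inj₁ (y≡u , x≡v)

  Joins-functional : ∀ {x y y′} → Joins x y → Joins x y′ → y ≡ y′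
  Joins-functional (inj₁ (_ , y≡v))    (inj₁ (_ , y′≡v))    = trans y≡v (sym y′≡v)
  Joins-functional (inj₁ (x≡u , y≡v))  (inj₂ (x≡v , y′≡u))  = trans y≡v (trans (sym x≡v) (trans x≡u (sym y′≡u)))
  Joins-functional (inj₂ (x≡v , y≡u))  (inj₁ (x≡u , y′≡v))  = trans y≡u (trans (sym x≡u) (trans x≡v (sym y′≡v)))
  Joins-functional (inj₂ (_ , y≡u))    (inj₂ (_ , y′≡u))    = trans y≡u (sym y′≡u)

removeEdge : (G : Graph) → Fin (n G) → Fin (n G) → Graph
removeEdge G u v = record
  { n          = n G
  ; adj        = λ x y → adj G x y ∧ not (does (joins? u v x y))
  ; adj-sym    = λ x y → cong₂ (λ a b → a ∧ not b) (adj-sym G x y)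
                           (does-⇔ (mk⇔ (Joins-sym u v) (Joins-sym u v)) (joins? u v x y) (joins? u v y x))
  ; adj-irrefl = λ x → cong (_∧ _) (adj-irrefl G x)
  }

module _ (G : Graph) (u v : Fin (n G)) where

  private
    H = removeEdge G u v

  removeEdge-⊆ : ∀ x y → adj H x y ≡ true → adj G x y ≡ true
  removeEdge-⊆ x y _ with adj G x y
  removeEdge-⊆ x y () | false
  removeEdge-⊆ x y _  | true = refl

  removeEdge-removes : ∀ {x y} → Joins u v x y → adj H x y ≡ false
  removeEdge-removes {x} {y} j =
    trans (cong (λ b → adj G x y ∧ not b) (dec-true (joins? u v x y) j)) (∧-zeroʳ (adj G x y))

  removeEdge-keeps : ∀ {x y} → ¬ Joins u v x y → adj H x y ≡ adj G x y
  removeEdge-keeps {x} {y} ¬j =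
    trans (cong (λ b → adj G x y ∧ not b) (dec-false (joins? u v x y) ¬j)) (∧-identityʳ (adj G x y))

  removeEdge-cycle : ∀ {k} → Cycle H k → Cycle G k
  removeEdge-cycle C = record
    { f     = f
    ; f-inj = f-inj
    ; steps = λ i → removeEdge-⊆ _ _ (steps i)
    ; close = removeEdge-⊆ _ _ close
    }
    where open Cycle C

  removeEdge-lost : ∀ x y → 𝟙 (adj H x y) < 𝟙 (adj G x y) → Joins u v x y
  removeEdge-lost x y lost with joins? u v x y
  ... | yes j = j
  ... | no ¬j = contradiction (subst (λ b → 𝟙 b < 𝟙 (adj G x y)) (removeEdge-keeps ¬j) lost)
                              (<-irrefl refl)

  degree-removeEdge-≢ : ∀ {x} → x ≢ u → x ≢ v → degree H x ≡ degree G x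
  degree-removeEdge-≢ {x} x≢u x≢v =
    cong List.sum (map-cong (λ y → cong 𝟙 (removeEdge-keeps (¬j y))) (allFin (n G)))
    where
    ¬j : ∀ y → ¬ Joins u v x y
    ¬j y (inj₁ (x≡u , _)) = x≢u x≡u
    ¬j y (inj₂ (x≡v , _)) = x≢v x≡v

  degree-removeEdge-≤ : ∀ x → degree G x ≤ suc (degree H x)
  degree-removeEdge-≤ x = begin
    degree G x                       ≡⟨ degree-∑ G x ⟩
    ∑[ y < n G ] 𝟙 (adj G x y)       ≤⟨ ∑-≤-suc (λ y → ≤-trans (𝟙≤1 (adj G x y)) (s≤s z≤n)) lost-unique ⟩
    suc (∑[ y < n G ] 𝟙 (adj H x y)) ≡⟨ cong suc (degree-∑ H x) ⟨
    suc (degree H x)                 ∎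
    where
    open ≤-Reasoning
    lost-unique : ∀ y y′ → 𝟙 (adj H x y) < 𝟙 (adj G x y) → 𝟙 (adj H x y′) < 𝟙 (adj G x y′) → y ≡ y′
    lost-unique y y′ lost lost′ = Joins-functional u v (removeEdge-lost x y lost) (removeEdge-lost x y′ lost′)

  ∣E∣-removeEdge-<-ordered : ∀ {x y} → toℕ x < toℕ y → adj G x y ≡ true → Joins u v x y →
                             ∣E∣ H < ∣E∣ G
  ∣E∣-removeEdge-<-ordered {x} {y} x<y xy∈G j = subst₂ _<_ (sym (∣E∣-∑ H)) (sym (∣E∣-∑ G))
    (∑-mono-< (λ x′ → ∑-mono-≤ (term-mono x′)) x (∑-mono-< (term-mono x) y term-drops))
    where
    term-mono : ∀ x′ y′ → 𝟙 (⌊ toℕ x′ <? toℕ y′ ⌋ ∧ adj H x′ y′) ≤ 𝟙 (⌊ toℕ x′ <? toℕ y′ ⌋ ∧ adj G x′ y′)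
    term-mono x′ y′ = 𝟙-∧-mono ⌊ toℕ x′ <? toℕ y′ ⌋ (removeEdge-⊆ x′ y′)
    term-drops : 𝟙 (⌊ toℕ x <? toℕ y ⌋ ∧ adj H x y) < 𝟙 (⌊ toℕ x <? toℕ y ⌋ ∧ adj G x y)
    term-drops with toℕ x <? toℕ y
    ... | yes _  rewrite removeEdge-removes j | xy∈G = s≤s z≤n
    ... | no x≮y = contradiction x<y x≮y

  ∣E∣-removeEdge-< : adj G u v ≡ true → ∣E∣ H < ∣E∣ G
  ∣E∣-removeEdge-< uv∈G with Fin.<-cmp u v
  ... | tri< u<v _ _  = ∣E∣-removeEdge-<-ordered u<v uv∈G (inj₁ (refl , refl))
  ... | tri≈ _ refl _ = contradiction (trans (sym uv∈G) (adj-irrefl G u)) λ ()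
  ... | tri> _ _ v<u  = ∣E∣-removeEdge-<-ordered v<u (trans (adj-sym G v u) uv∈G) (inj₂ (refl , refl))

removeEdge-counterexample : ∀ G u v → Counterexample G → 4 ≤ degree G u → 4 ≤ degree G v →
                            Counterexample (removeEdge G u v)
removeEdge-counterexample G u v (nonempty , δ≥3 , no-cycle) 4≤du 4≤dv =
  nonempty , δ′≥3 , λ k k-pow (m , k≡m+3 , C) → no-cycle k k-pow (m , k≡m+3 , removeEdge-cycle G u v C)
  where
  δ′≥3 : MinDegreeAtLeast (removeEdge G u v) 3
  δ′≥3 x = by-cases (x Fin.≟ u) (x Fin.≟ v)
    where
    from-4≤ : ∀ {w} → x ≡ w → 4 ≤ degree G w → 3 ≤ degree (removeEdge G u v) x
    from-4≤ refl 4≤dx = s≤s⁻¹ (≤-trans 4≤dx (degree-removeEdge-≤ G u v x))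
    by-cases : Dec (x ≡ u) → Dec (x ≡ v) → 3 ≤ degree (removeEdge G u v) x
    by-cases (yes x≡u) _         = from-4≤ x≡u 4≤du
    by-cases (no _)    (yes x≡v) = from-4≤ x≡v 4≤dv
    by-cases (no x≢u)  (no x≢v)  = subst (3 ≤_) (sym (degree-removeEdge-≢ G u v x≢u x≢v)) (δ≥3 x)

EveryEdgeMeetsV₃ : Graph → Set
EveryEdgeMeetsV₃ G = ∀ u v → adj G u v ≡ true → degree G u ≡ 3 ⊎ degree G v ≡ 3

minimal⇒everyEdgeMeetsV₃ : ∀ G → MinimalCounterexample G → EveryEdgeMeetsV₃ G
minimal⇒everyEdgeMeetsV₃ G (counterexample@(_ , δ≥3 , _) , minimal) u v uv∈G
  with degree G u ≟ 3 | degree G v ≟ 3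
... | yes du≡3 | _        = inj₁ du≡3
... | no _     | yes dv≡3 = inj₂ dv≡3
... | no du≢3  | no dv≢3  =
  contradiction (proj₂ (minimal _ (removeEdge-counterexample G u v counterexample (4≤ du≢3) (4≤ dv≢3))) refl)
                (<⇒≱ (∣E∣-removeEdge-< G u v uv∈G))
  where
  4≤ : ∀ {x} → degree G x ≢ 3 → 4 ≤ degree G x
  4≤ {x} dx≢3 = ≤∧≢⇒< (δ≥3 x) (dx≢3 ∘ sym)

module _ (G : Graph) (δ≥3 : MinDegreeAtLeast G 3) (meets : EveryEdgeMeetsV₃ G) where

  private
    N = n G
    d = degree G
    A : Fin N → Fin N → ℕ
    A x y = 𝟙 (adj G x y)
    isV₃ : Fin N → Bool
    isV₃ x = ⌊ d x ≟ 3 ⌋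
    low high : Fin N → ℕ
    low  x = 𝟙 (isV₃ x)
    high x = 𝟙 (not (isV₃ x))

    4·high≤high·d : ∀ x → 4 * high x ≤ high x * d x
    4·high≤high·d x with d x ≟ 3
    ... | yes _   = z≤n
    ... | no dx≢3 = subst (4 ≤_) (sym (+-identityʳ (d x))) (≤∧≢⇒< (δ≥3 x) (dx≢3 ∘ sym))

    isV₃-true : ∀ {x} → d x ≡ 3 → isV₃ x ≡ true
    isV₃-true {x} dx≡3 = trans (isYes≗does (d x ≟ 3)) (dec-true (d x ≟ 3) dx≡3)

    high·A≤low·A : ∀ x y → high x * A x y ≤ low y * A y x
    high·A≤low·A x y with adj G x y in xy∈G
    ... | false = ≤-trans (≤-reflexive (*-zeroʳ (high x))) z≤n
    ... | true with meets x y xy∈G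
    ...   | inj₁ dx≡3 = ≤-trans (≤-reflexive (cong (λ b → 𝟙 (not b) * 1) (isV₃-true dx≡3))) z≤n
    ...   | inj₂ dy≡3 = begin
      high x * 1     ≡⟨ *-identityʳ (high x) ⟩
      high x         ≤⟨ 𝟙≤1 (not (isV₃ x)) ⟩
      1              ≡⟨ cong₂ (λ b c → 𝟙 b * 𝟙 c) (isV₃-true dy≡3) (trans (adj-sym G y x) xy∈G) ⟨
      low y * A y x  ∎
      where open ≤-Reasoning

    low·d≡3·low : ∀ y → low y * d y ≡ 3 * low y
    low·d≡3·low y with d y ≟ 3
    ... | yes dy≡3 = trans (+-identityʳ (d y)) dy≡3
    ... | no _     = refl

    #high #low : ℕ
    #high = ∑[ x < N ] high x
    #low  = ∑[ y < N ] low y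

    4·#high≤3·#low : 4 * #high ≤ 3 * #low
    4·#high≤3·#low = begin
      4 * #high                                ≡⟨ *-distribˡ-sum 4 high ⟩
      ∑[ x < N ] (4 * high x)                  ≤⟨ ∑-mono-≤ 4·high≤high·d ⟩
      ∑[ x < N ] (high x * d x)                ≡⟨ sum-cong-≗ (λ x → cong (high x *_) (degree-∑ G x)) ⟩
      ∑[ x < N ] (high x * ∑[ y < N ] A x y)   ≡⟨ sum-cong-≗ (λ x → *-distribˡ-sum (high x) (A x)) ⟩
      ∑[ x < N ] ∑[ y < N ] (high x * A x y)   ≤⟨ ∑-mono-≤ (λ x → ∑-mono-≤ (high·A≤low·A x)) ⟩
      ∑[ x < N ] ∑[ y < N ] (low y * A y x)    ≡⟨ ∑-comm (λ x y → low y * A y x) ⟩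
      ∑[ y < N ] ∑[ x < N ] (low y * A y x)    ≡⟨ sum-cong-≗ (λ y → *-distribˡ-sum (low y) (A y)) ⟨
      ∑[ y < N ] (low y * ∑[ x < N ] A y x)    ≡⟨ sum-cong-≗ (λ y → cong (low y *_) (degree-∑ G y)) ⟨
      ∑[ y < N ] (low y * d y)                 ≡⟨ sum-cong-≗ low·d≡3·low ⟩
      ∑[ y < N ] (3 * low y)                   ≡⟨ *-distribˡ-sum 3 low ⟨
      3 * #low                                 ∎
      where open ≤-Reasoning

    N≡#high+#low : N ≡ #high + #low
    N≡#high+#low = begin
      N                            ≡⟨ ∑-1 N ⟨
      ∑[ x < N ] 1                 ≡⟨ sum-cong-≗ (λ x → 𝟙-not+𝟙 (isV₃ x)) ⟨
      ∑[ x < N ] (high x + low x)  ≡⟨ ∑-distrib-+ high low ⟩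
      #high + #low                 ∎
      where open ≡-Reasoning

  4∣V∣≤7∣V₃∣ : 4 * ∣V∣ G ≤ 7 * ∣V₃∣ G
  4∣V∣≤7∣V₃∣ = begin
    4 * N                    ≡⟨ cong (4 *_) N≡#high+#low ⟩
    4 * (#high + #low)       ≡⟨ *-distribˡ-+ 4 #high #low ⟩
    4 * #high + 4 * #low     ≤⟨ +-monoˡ-≤ (4 * #low) 4·#high≤3·#low ⟩
    3 * #low + 4 * #low      ≡⟨ *-distribʳ-+ #low 3 4 ⟨
    7 * #low                 ≡⟨ cong (7 *_) (sum-map-allFin N low) ⟨
    7 * ∣V₃∣ G               ∎
    where open ≤-Reasoning

theorem0p1 : (G : Graph) → MinimalCounterexample G → 4 * ∣V∣ G ≤ 7 * ∣V₃∣ G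
theorem0p1 G minimal@((_ , δ≥3 , _) , _) =
  4∣V∣≤7∣V₃∣ G δ≥3 (minimal⇒everyEdgeMeetsV₃ G minimal)
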